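{- Let $0\le \alpha\le 1$. There exists a set $A\subseteq\mathbb{N}_0$ with $0\in A$ and $\gcd(A)=1$ such that the asymptotic density of $A$ exists and equals $\alpha$, and the asymptotic density of $A+A=\{a+b: a,b\in A\}$ exists and equals $1$.
   Context: $\mathbb{N}_0=\{0,1,2,\dots\}$. For $A\subseteq\mathbb{N}_0$, the lower and upper asymptotic densities are $\liminf_{n\to\infty}|A\cap[1,n]|/n$ and $\limsup_{n\to\infty}|A\cap[1,n]|/n$; if they coincide, the common value is the asymptotic density $\mathbf{d}A$. A set is called normalized if it contains $0$ and the gcd of its elements is $1$. -}

module Defs where

open import Data.Bool using (Bool; true; false; _∧_; _∨_; T)
open import Data.Nat using (ℕ; zero; suc; _∸_) renaming (_≤_ to _≤ℕ_)
open import Data.Nat.Divisibility using (_∣_)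
open import Data.Integer using (+_)
open import Data.Rational using (ℚ; _/_; _+_; _-_; -_; ∣_∣; _≤_; 0ℚ; 1ℚ)
open import Data.Rational.Properties using (nonNegative⁻¹; pos⇒nonNeg; normalize-pos; +-mono-≤)
open import Data.Product using (∃; _×_)
open import Relation.Binary.PropositionalEquality using (_≡_)

NSet : Set
NSet = ℕ → Bool

inv : ℕ → ℚ
inv k = + 1 / suc k

-- Real numbers à la Bishop: regular Cauchy sequences of rationals,
-- |x_m - x_n| ≤ 1/(m+1) + 1/(n+1).
record ℝ : Set where
  field
    seq : ℕ → ℚ
    reg : ∀ m n → ∣ seq m - seq n ∣ ≤ inv m + inv n
open ℝ public

-- 0 ≤ x ≤ 1 for a Bishop real (x ≥ 0 iff x_n ≥ -1/(n+1) for all n)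
InUnitInterval : ℝ → Set
InUnitInterval x = ∀ n → (- inv n ≤ seq x n) × (seq x n ≤ 1ℚ + inv n)

count : NSet → ℕ → ℕ
count A zero = 0
count A (suc n) with A (suc n)
... | true  = suc (count A n)
... | false = count A n

ratio : NSet → ℕ → ℚ
ratio A n = + count A (suc n) / suc n

inv-nonneg : ∀ k → 0ℚ ≤ inv k
inv-nonneg k = nonNegative⁻¹ (inv k) {{pos⇒nonNeg (inv k) {{normalize-pos 1 (suc k)}}}}

oneℝ : ℝ
oneℝ = record { seq = λ _ → 1ℚ ; reg = λ m n → +-mono-≤ (inv-nonneg m) (inv-nonneg n) }

-- the density of A exists and equals α :  ratio A n → α  as n → ∞
-- (for a Bishop real α: ∀ k ∃ N ∀ n ≥ N, |ratio A n - α| ≤ 1/(k+1),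
--  expressed against the approximations α_m:  |ratio A n - α_m| ≤ 1/(k+1) + 1/(m+1))
HasDensity : NSet → ℝ → Set
HasDensity A α = ∀ k → ∃ λ N → ∀ n → N ≤ℕ n → ∀ m → ∣ ratio A n - seq α m ∣ ≤ inv k + inv m

sumsetAux : NSet → ℕ → ℕ → Bool
sumsetAux A s zero = A 0 ∧ A s
sumsetAux A s (suc a) = (A (suc a) ∧ A (s ∸ suc a)) ∨ sumsetAux A s a

SumSet : NSet → NSet
SumSet A s = sumsetAux A s s

GcdOne : NSet → Set
GcdOne A = ∀ d → (∀ a → T (A a) → d ∣ a) → d ≡ 1

Normalized : NSet → Set
Normalized A = T (A 0) × GcdOne A

module Submission where

-- Let B be the set of numbers whose base-4 digits all lie in {0,1}, or all lie in {0,2}.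
-- Below 4^j each kind has 2^j elements, so B has O(√n) elements below n and density 0;
-- yet B + B = ℕ₀, since every digit 0,1,2,3 is a digit in {0,1} plus a digit in {0,2}.
-- Adding to B ∪ {0} every n+1 for which the count so far is below (n+1)α gives a set A whose
-- count stays within 2 + |B ∩ [1,n]| of nα, hence A has density α; A + A ⊇ B + B = ℕ₀, and
-- 1 ∈ B makes gcd(A) = 1.

open import Defs
open import Data.Product using (∃; _×_)

module Counting where
  open import Data.Bool using (Bool; true; false; _∧_; _∨_; T)
  open import Data.Bool.Properties using (∨-zeroʳ)
  open import Data.Nat
  open import Data.Nat.Properties
  open import Data.Nat.Divisibility using (∣1⇒≡1)
  open import Data.Product using (∃; _,_)
  open import Relation.Binary.PropositionalEquality
  open import Relation.Nullary using (yes; no)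

  bit : Bool → ℕ
  bit true = 1
  bit false = 0

  bit-∧ : ∀ b c → bit (b ∧ c) ≡ bit b * bit c
  bit-∧ true c = sym (+-identityʳ (bit c))
  bit-∧ false c = refl

  ∨-introˡ : ∀ {a b} → a ≡ true → a ∨ b ≡ true
  ∨-introˡ refl = refl

  _∪_ : NSet → NSet → NSet
  (X ∪ Y) n = X n ∨ Y n

  ∪-introˡ : ∀ X Y {n} → X n ≡ true → (X ∪ Y) n ≡ true
  ∪-introˡ X Y = ∨-introˡ

  ∪-introʳ : ∀ X Y {n} → Y n ≡ true → (X ∪ Y) n ≡ true
  ∪-introʳ X Y {n} n∈Y rewrite n∈Y = ∨-zeroʳ (X n)

  count-suc : ∀ A n → count A (suc n) ≡ bit (A (suc n)) + count A n
  count-suc A n with A (suc n)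
  ... | true = refl
  ... | false = refl

  count-full : ∀ X → (∀ s → X s ≡ true) → ∀ n → count X n ≡ n
  count-full X full zero = refl
  count-full X full (suc n) =
    trans (count-suc X n) (cong₂ (λ b c → bit b + c) (full (suc n)) (count-full X full n))

  count-∪ : ∀ X Y n → count (X ∪ Y) n ≤ count X n + count Y n
  count-∪ X Y zero = z≤n
  count-∪ X Y (suc n) with X (suc n) | Y (suc n)
  ... | true  | true  = s≤s (≤-trans (count-∪ X Y n) (+-monoʳ-≤ (count X n) (n≤1+n _)))
  ... | true  | false = s≤s (count-∪ X Y n)
  ... | false | true  = ≤-trans (s≤s (count-∪ X Y n)) (≤-reflexive (sym (+-suc _ _)))
  ... | false | false = count-∪ X Y n

  -- |A ∩ [0,n)|, which unlike count includes 0
  countBelow : NSet → ℕ → ℕ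
  countBelow A zero = 0
  countBelow A (suc n) = countBelow A n + bit (A n)

  count≤countBelow : ∀ A n → count A n ≤ countBelow A (suc n)
  count≤countBelow A zero = z≤n
  count≤countBelow A (suc n) with A (suc n)
  ... | true = ≤-trans (s≤s (count≤countBelow A n)) (≤-reflexive (+-comm 1 _))
  ... | false = ≤-trans (count≤countBelow A n) (m≤m+n _ 0)

  countBelow-mono : ∀ A {m n} → m ≤ n → countBelow A m ≤ countBelow A n
  countBelow-mono A {n = zero} z≤n = ≤-refl
  countBelow-mono A {m} {suc n} m≤1+n with m ≟ suc n
  ... | yes refl = ≤-refl
  ... | no m≢1+n = ≤-trans (countBelow-mono A (≤-pred (≤∧≢⇒< m≤1+n m≢1+n))) (m≤m+n _ _)

  -- Density zero, with room for the additive error 2 of the greedy construction.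
  Sparse : NSet → Set
  Sparse B = ∀ k → ∃ λ N → ∀ n → N ≤ n → (2 + count B n) * suc k ≤ n

  sumsetAux-intro : ∀ A s a {b} → b ≤ a → A b ≡ true → A (s ∸ b) ≡ true → sumsetAux A s a ≡ true
  sumsetAux-intro A s zero z≤n b∈A s∸b∈A = cong₂ _∧_ b∈A s∸b∈A
  sumsetAux-intro A s (suc a) {b} b≤1+a b∈A s∸b∈A with b ≟ suc a
  ... | yes refl rewrite b∈A | s∸b∈A = refl
  ... | no b≢1+a rewrite sumsetAux-intro A s a (≤-pred (≤∧≢⇒< b≤1+a b≢1+a)) b∈A s∸b∈A = ∨-zeroʳ _

  SumSet-intro : ∀ A {a b} → A a ≡ true → A b ≡ true → SumSet A (a + b) ≡ true
  SumSet-intro A {a} {b} a∈A b∈A = sumsetAux-intro A (a + b) (a + b) (m≤n+m b a) b∈A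
    (subst (λ x → A x ≡ true) (sym (m+n∸n≡m a b)) a∈A)

  0∈∧1∈⇒Normalized : ∀ A → T (A 0) → T (A 1) → Normalized A
  0∈∧1∈⇒Normalized A 0∈A 1∈A = 0∈A , λ d d∣A → ∣1⇒≡1 (d∣A 1 1∈A)

module Base4Digits where
  open Counting
  open import Data.Bool using (Bool; true; false; _∧_)
  open import Data.Nat
  open import Data.Nat.Properties
  open import Data.Nat.DivMod
  open import Data.Nat.Divisibility using (divides-refl)
  open import Data.Nat.Solver using (module +-*-Solver)
  open import Data.Product using (∃₂; _×_; _,_)
  open import Relation.Binary.PropositionalEquality
  open import Relation.Nullary using (yes; no)
  open import Data.Empty using (⊥-elim)
  open +-*-Solver

  -- The fuel f bounds the number of base-4 digits inspected; any f ≥ n suffices.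
  digitsWithin : (ℕ → Bool) → ℕ → ℕ → Bool
  digitsWithin P zero n = true
  digitsWithin P (suc f) n = P (n % 4) ∧ digitsWithin P f (n / 4)

  digitsIn : (ℕ → Bool) → NSet
  digitsIn P n = digitsWithin P (suc n) n

  [r+i*4]%4≡r : ∀ r i → r < 4 → (r + i * 4) % 4 ≡ r
  [r+i*4]%4≡r r i r<4 = trans ([m+kn]%n≡m%n r i 4) (m<n⇒m%n≡m r<4)

  [r+i*4]/4≡i : ∀ r i → r < 4 → (r + i * 4) / 4 ≡ i
  [r+i*4]/4≡i r i r<4 =
    trans (+-distrib-/-∣ʳ r (divides-refl i)) (cong₂ _+_ (m<n⇒m/n≡0 r<4) (m*n/n≡m i 4))

  n≤1+f⇒n/4≤f : ∀ n f → n ≤ suc f → n / 4 ≤ f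
  n≤1+f⇒n/4≤f zero f _ = z≤n
  n≤1+f⇒n/4≤f n@(suc _) f n≤1+f = ≤-pred (≤-trans (m/n<m n 4 (s≤s (s≤s z≤n))) n≤1+f)

  module DigitsIn (P : ℕ → Bool) (P0 : P 0 ≡ true) where

    digitsWithin-0 : ∀ f → digitsWithin P f 0 ≡ true
    digitsWithin-0 zero = refl
    digitsWithin-0 (suc f) rewrite P0 = digitsWithin-0 f

    digitsWithin-stable : ∀ f g n → n ≤ f → n ≤ g → digitsWithin P f n ≡ digitsWithin P g n
    digitsWithin-stable zero g .zero z≤n _ = sym (digitsWithin-0 g)
    digitsWithin-stable (suc f) zero .zero _ z≤n = digitsWithin-0 (suc f)
    digitsWithin-stable (suc f) (suc g) n n≤1+f n≤1+g = cong (P (n % 4) ∧_)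
      (digitsWithin-stable f g (n / 4) (n≤1+f⇒n/4≤f n f n≤1+f) (n≤1+f⇒n/4≤f n g n≤1+g))

    digitsIn-0 : digitsIn P 0 ≡ true
    digitsIn-0 = digitsWithin-0 1

    digitsIn-digit : ∀ r i → r < 4 → digitsIn P (r + i * 4) ≡ P r ∧ digitsIn P i
    digitsIn-digit r i r<4 rewrite [r+i*4]%4≡r r i r<4 | [r+i*4]/4≡i r i r<4 =
      cong (P r ∧_) (digitsWithin-stable (r + i * 4) (suc i) i
        (≤-trans (m≤m*n i 4) (m≤n+m (i * 4) r)) (n≤1+n i))

  module DigitsInCount (P : ℕ → Bool) (P0 : P 0 ≡ true)
                       {d : ℕ} (size : bit (P 0) + bit (P 1) + bit (P 2) + bit (P 3) ≡ d) where
    open DigitsIn P P0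

    bit-digitsIn-digit : ∀ r M → r < 4 → bit (digitsIn P (r + M * 4)) ≡ bit (P r) * bit (digitsIn P M)
    bit-digitsIn-digit r M r<4 = trans (cong bit (digitsIn-digit r M r<4)) (bit-∧ (P r) (digitsIn P M))

    countBelow-*4 : ∀ M → countBelow (digitsIn P) (M * 4) ≡ d * countBelow (digitsIn P) M
    countBelow-*4 zero = sym (*-zeroʳ d)
    countBelow-*4 (suc M) = begin
        countBelow (digitsIn P) (suc M * 4)
      ≡⟨ cong₂ _+_ (cong₂ _+_ (cong₂ _+_ (cong₂ _+_ (countBelow-*4 M)
           (bit-digitsIn-digit 0 M (s≤s z≤n))) (bit-digitsIn-digit 1 M (s≤s (s≤s z≤n))))
           (bit-digitsIn-digit 2 M (s≤s (s≤s (s≤s z≤n))))) (bit-digitsIn-digit 3 M ≤-refl) ⟩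
        d * c + bit (P 0) * x + bit (P 1) * x + bit (P 2) * x + bit (P 3) * x
      ≡⟨ solve 7 (λ d c x p₀ p₁ p₂ p₃ →
             d :* c :+ p₀ :* x :+ p₁ :* x :+ p₂ :* x :+ p₃ :* x := d :* c :+ (p₀ :+ p₁ :+ p₂ :+ p₃) :* x)
           refl d c x (bit (P 0)) (bit (P 1)) (bit (P 2)) (bit (P 3)) ⟩
        d * c + (bit (P 0) + bit (P 1) + bit (P 2) + bit (P 3)) * x
      ≡⟨ cong (λ e → d * c + e * x) size ⟩
        d * c + d * x
      ≡⟨ sym (*-distribˡ-+ d c x) ⟩
        d * countBelow (digitsIn P) (suc M) ∎
      where open ≡-Reasoning
            c = countBelow (digitsIn P) M
            x = bit (digitsIn P M)

    countBelow-4^ : ∀ j → countBelow (digitsIn P) (4 ^ j) ≡ d ^ j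
    countBelow-4^ zero rewrite digitsIn-0 = refl
    countBelow-4^ (suc j) = begin
        countBelow (digitsIn P) (4 * 4 ^ j)
      ≡⟨ cong (countBelow (digitsIn P)) (*-comm 4 (4 ^ j)) ⟩
        countBelow (digitsIn P) (4 ^ j * 4)
      ≡⟨ countBelow-*4 (4 ^ j) ⟩
        d * countBelow (digitsIn P) (4 ^ j)
      ≡⟨ cong (d *_) (countBelow-4^ j) ⟩
        d * d ^ j ∎
      where open ≡-Reasoning

  2^j*2^j≡4^j : ∀ j → 2 ^ j * 2 ^ j ≡ 4 ^ j
  2^j*2^j≡4^j zero = refl
  2^j*2^j≡4^j (suc j) = trans (solve 1 (λ a → (con 2 :* a) :* (con 2 :* a) := con 4 :* (a :* a)) refl (2 ^ j))
                              (cong (4 *_) (2^j*2^j≡4^j j))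

  n≤4^n : ∀ n → n ≤ 4 ^ n
  n≤4^n zero = z≤n
  n≤4^n (suc n) = begin
      1 + n           ≤⟨ +-mono-≤ (m^n>0 4 n) (n≤4^n n) ⟩
      4 ^ n + 4 ^ n   ≤⟨ +-monoʳ-≤ (4 ^ n) (m≤m+n (4 ^ n) _) ⟩
      4 * 4 ^ n       ∎
    where open ≤-Reasoning

  module TwoDigits (P : ℕ → Bool) (P0 : P 0 ≡ true)
                   (size : bit (P 0) + bit (P 1) + bit (P 2) + bit (P 3) ≡ 2) where
    open DigitsIn P P0
    open DigitsInCount P P0 size

    countBelow-sq≤-below-4^ : ∀ j n → n ≤ 4 ^ j →
      countBelow (digitsIn P) n * countBelow (digitsIn P) n ≤ 4 * n
    countBelow-sq≤-below-4^ zero zero _ = z≤n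
    countBelow-sq≤-below-4^ zero (suc zero) _ rewrite digitsIn-0 = s≤s z≤n
    countBelow-sq≤-below-4^ zero (suc (suc n)) (s≤s ())
    countBelow-sq≤-below-4^ (suc j) n n≤4^[1+j] with n ≤? 4 ^ j
    ... | yes n≤4^j = countBelow-sq≤-below-4^ j n n≤4^j
    ... | no n≰4^j = begin
        c * c               ≤⟨ *-mono-≤ c≤2^[1+j] c≤2^[1+j] ⟩
        2 ^ suc j * 2 ^ suc j ≡⟨ 2^j*2^j≡4^j (suc j) ⟩
        4 * 4 ^ j           ≤⟨ *-monoʳ-≤ 4 (<⇒≤ (≰⇒> n≰4^j)) ⟩
        4 * n               ∎
      where
        open ≤-Reasoning
        c = countBelow (digitsIn P) n
        c≤2^[1+j] : c ≤ 2 ^ suc j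
        c≤2^[1+j] = ≤-trans (countBelow-mono (digitsIn P) n≤4^[1+j]) (≤-reflexive (countBelow-4^ (suc j)))

    countBelow-sq≤ : ∀ n → countBelow (digitsIn P) n * countBelow (digitsIn P) n ≤ 4 * n
    countBelow-sq≤ n = countBelow-sq≤-below-4^ n n (n≤4^n n)

  zeroOrOne : ℕ → Bool
  zeroOrOne 0 = true
  zeroOrOne 1 = true
  zeroOrOne _ = false

  zeroOrTwo : ℕ → Bool
  zeroOrTwo 0 = true
  zeroOrTwo 2 = true
  zeroOrTwo _ = false

  digits01 : NSet
  digits01 = digitsIn zeroOrOne

  digits02 : NSet
  digits02 = digitsIn zeroOrTwo

  private
    module D01 = DigitsIn zeroOrOne refl
    module D02 = DigitsIn zeroOrTwo refl

  Split : ℕ → Set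
  Split s = ∃₂ λ e g → digits01 e ≡ true × digits02 g ≡ true × e + g ≡ s

  -- Each base-4 digit r splits as r = r₀₁ + r₀₂ with r₀₁ ∈ {0,1} and r₀₂ ∈ {0,2}.
  split-digit : ∀ r {s} → r < 4 → Split s → Split (r + s * 4)
  split-digit 0 _ (e , g , e∈ , g∈ , refl) =
    e * 4 , g * 4 , trans (D01.digitsIn-digit 0 e (s≤s z≤n)) e∈ , trans (D02.digitsIn-digit 0 g (s≤s z≤n)) g∈ ,
    sym (*-distribʳ-+ 4 e g)
  split-digit 1 _ (e , g , e∈ , g∈ , refl) =
    1 + e * 4 , g * 4 , trans (D01.digitsIn-digit 1 e (s≤s (s≤s z≤n))) e∈ , trans (D02.digitsIn-digit 0 g (s≤s z≤n)) g∈ ,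
    cong suc (sym (*-distribʳ-+ 4 e g))
  split-digit 2 _ (e , g , e∈ , g∈ , refl) =
    e * 4 , 2 + g * 4 , trans (D01.digitsIn-digit 0 e (s≤s z≤n)) e∈ , trans (D02.digitsIn-digit 2 g (s≤s (s≤s (s≤s z≤n)))) g∈ ,
    solve 2 (λ e g → e :* con 4 :+ (con 2 :+ g :* con 4) := con 2 :+ (e :+ g) :* con 4) refl e g
  split-digit 3 _ (e , g , e∈ , g∈ , refl) =
    1 + e * 4 , 2 + g * 4 , trans (D01.digitsIn-digit 1 e (s≤s (s≤s z≤n))) e∈ , trans (D02.digitsIn-digit 2 g (s≤s (s≤s (s≤s z≤n)))) g∈ ,
    solve 2 (λ e g → con 1 :+ e :* con 4 :+ (con 2 :+ g :* con 4) := con 3 :+ (e :+ g) :* con 4) refl e g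
  split-digit (suc (suc (suc (suc _)))) (s≤s (s≤s (s≤s (s≤s ())))) _

  split-≤ : ∀ f s → s ≤ f → Split s
  split-≤ zero .zero z≤n = 0 , 0 , refl , refl , refl
  split-≤ (suc f) s s≤1+f = subst Split (sym (m≡m%n+[m/n]*n s 4))
    (split-digit (s % 4) (m%n<n s 4) (split-≤ f (s / 4) (n≤1+f⇒n/4≤f s f s≤1+f)))

  split : ∀ s → Split s
  split s = split-≤ s s ≤-refl

  thinBasis : NSet
  thinBasis = digits01 ∪ digits02

  m*m≤n*n⇒m≤n : ∀ m n → m * m ≤ n * n → m ≤ n
  m*m≤n*n⇒m≤n m n mm≤nn with m ≤? n
  ... | yes m≤n = m≤n
  ... | no m≰n = ⊥-elim (<⇒≱ (*-mono-< (≰⇒> m≰n) (≰⇒> m≰n)) mm≤nn)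

  -- x ≤ 2√t and 8K ≤ √t
  4Kx≤t : ∀ K x t → x * x ≤ 4 * t → 64 * (K * K) ≤ t → 4 * K * x ≤ t
  4Kx≤t K x t xx≤4t 64KK≤t = m*m≤n*n⇒m≤n (4 * K * x) t (begin
      4 * K * x * (4 * K * x)  ≡⟨ solve 2 (λ K x → con 4 :* K :* x :* (con 4 :* K :* x) := con 16 :* (K :* K) :* (x :* x)) refl K x ⟩
      16 * (K * K) * (x * x)   ≤⟨ *-monoʳ-≤ (16 * (K * K)) xx≤4t ⟩
      16 * (K * K) * (4 * t)   ≡⟨ solve 2 (λ K t → con 16 :* (K :* K) :* (con 4 :* t) := con 64 :* (K :* K) :* t) refl K t ⟩
      64 * (K * K) * t         ≤⟨ *-monoˡ-≤ t 64KK≤t ⟩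
      t * t                    ∎)
    where open ≤-Reasoning

  private
    module C01 = TwoDigits zeroOrOne refl refl
    module C02 = TwoDigits zeroOrTwo refl refl

  4K+1≤64K² : ∀ K .{{_ : NonZero K}} → 4 * K + 1 ≤ 64 * (K * K)
  4K+1≤64K² K = begin
      4 * K + 1      ≤⟨ +-monoʳ-≤ (4 * K) (>-nonZero⁻¹ K) ⟩
      4 * K + K      ≡⟨ solve 1 (λ K → con 4 :* K :+ K := con 5 :* K) refl K ⟩
      5 * K          ≤⟨ *-monoˡ-≤ K (m≤m+n 5 59) ⟩
      64 * K         ≤⟨ *-monoʳ-≤ 64 (m≤m*n K K) ⟩
      64 * (K * K)   ∎
    where open ≤-Reasoning

  count-thinBasis : ∀ K .{{_ : NonZero K}} n → 64 * (K * K) ≤ n → (2 + count thinBasis n) * K ≤ n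
  count-thinBasis K n N≤n = *-cancelˡ-≤ 4 (begin
      4 * ((2 + count thinBasis n) * K)
    ≤⟨ *-monoʳ-≤ 4 (*-monoˡ-≤ K (+-monoʳ-≤ 2 (≤-trans (count-∪ digits01 digits02 n)
         (+-mono-≤ (count≤countBelow digits01 n) (count≤countBelow digits02 n))))) ⟩
      4 * ((2 + (x + y)) * K)
    ≡⟨ solve 3 (λ K x y → con 4 :* ((con 2 :+ (x :+ y)) :* K) := con 8 :* K :+ con 4 :* K :* x :+ con 4 :* K :* y) refl K x y ⟩
      8 * K + 4 * K * x + 4 * K * y
    ≤⟨ +-mono-≤ (+-monoʳ-≤ (8 * K) (4Kx≤t K x (suc n) (C01.countBelow-sq≤ (suc n)) (m≤n⇒m≤1+n N≤n)))
                (4Kx≤t K y (suc n) (C02.countBelow-sq≤ (suc n)) (m≤n⇒m≤1+n N≤n)) ⟩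
      8 * K + suc n + suc n
    ≡⟨ solve 2 (λ K n → con 8 :* K :+ (con 1 :+ n) :+ (con 1 :+ n) := con 2 :* (con 4 :* K :+ con 1) :+ con 2 :* n) refl K n ⟩
      2 * (4 * K + 1) + 2 * n
    ≤⟨ +-monoˡ-≤ (2 * n) (*-monoʳ-≤ 2 (≤-trans (4K+1≤64K² K) N≤n)) ⟩
      2 * n + 2 * n
    ≡⟨ solve 1 (λ n → con 2 :* n :+ con 2 :* n := con 4 :* n) refl n ⟩
      4 * n ∎)
    where
      open ≤-Reasoning
      x = countBelow digits01 (suc n)
      y = countBelow digits02 (suc n)

  thinBasis-sparse : Sparse thinBasis
  thinBasis-sparse k = 64 * (suc k * suc k) , count-thinBasis (suc k)

module Rationals where
  open Counting using (count-full)
  open import Data.Nat as ℕ using (ℕ; zero; suc)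
  open import Data.Integer as ℤ using (+_)
  import Data.Integer.Properties as ℤ
  import Data.Integer.Solver as ℤ-Solver
  open import Data.Rational
  open import Data.Rational.Properties
  import Data.Rational.Unnormalised as ℚᵘ
  import Data.Rational.Unnormalised.Properties as ℚᵘ
  open import Data.Rational.Solver using (module +-*-Solver)
  open import Data.Sum using (inj₁; inj₂)
  open import Data.Product using (_,_)
  open import Data.Bool using (true)
  open import Relation.Binary.PropositionalEquality
  open +-*-Solver
  private
    module ℤS = ℤ-Solver.+-*-Solver

  -- Recursive rather than + a / 1, so that fromℕ (suc a) reduces to 1ℚ + fromℕ a.
  fromℕ : ℕ → ℚ
  fromℕ zero = 0ℚ
  fromℕ (suc a) = 1ℚ + fromℕ a

  fromℕ-+ : ∀ a b → fromℕ (a ℕ.+ b) ≡ fromℕ a + fromℕ b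
  fromℕ-+ zero b = sym (+-identityˡ (fromℕ b))
  fromℕ-+ (suc a) b = trans (cong (_+_ 1ℚ) (fromℕ-+ a b)) (sym (+-assoc 1ℚ (fromℕ a) (fromℕ b)))

  fromℕ-* : ∀ a b → fromℕ (a ℕ.* b) ≡ fromℕ a * fromℕ b
  fromℕ-* zero b = sym (*-zeroˡ (fromℕ b))
  fromℕ-* (suc a) b = begin
      fromℕ (b ℕ.+ a ℕ.* b)          ≡⟨ fromℕ-+ b (a ℕ.* b) ⟩
      fromℕ b + fromℕ (a ℕ.* b)      ≡⟨ cong (_+_ (fromℕ b)) (fromℕ-* a b) ⟩
      fromℕ b + fromℕ a * fromℕ b    ≡⟨ solve 2 (λ a b → b :+ a :* b := (con 1ℚ :+ a) :* b) refl (fromℕ a) (fromℕ b) ⟩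
      (1ℚ + fromℕ a) * fromℕ b       ∎
    where open ≡-Reasoning

  0≤fromℕ : ∀ a → 0ℚ ≤ fromℕ a
  0≤fromℕ zero = ≤-refl
  0≤fromℕ (suc a) = +-mono-≤ 0≤1 (0≤fromℕ a)
    where 0≤1 : 0ℚ ≤ 1ℚ
          0≤1 = *≤* (ℤ.+≤+ ℕ.z≤n)

  fromℕ-mono-≤ : ∀ {a b} → a ℕ.≤ b → fromℕ a ≤ fromℕ b
  fromℕ-mono-≤ {b = b} ℕ.z≤n = 0≤fromℕ b
  fromℕ-mono-≤ (ℕ.s≤s a≤b) = +-monoʳ-≤ 1ℚ (fromℕ-mono-≤ a≤b)

  toℚᵘ-/ : ∀ i d → toℚᵘ (i / suc d) ℚᵘ.≃ ℚᵘ.mkℚᵘ i d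
  toℚᵘ-/ i d = toℚᵘ-fromℚᵘ (ℚᵘ.mkℚᵘ i d)

  /-distribˡ-+ : ∀ a b n → + (a ℕ.+ b) / suc n ≡ + a / suc n + + b / suc n
  /-distribˡ-+ a b n = toℚᵘ-injective (begin
      toℚᵘ (+ (a ℕ.+ b) / suc n)                       ≈⟨ toℚᵘ-/ (+ (a ℕ.+ b)) n ⟩
      ℚᵘ.mkℚᵘ (+ (a ℕ.+ b)) n                           ≈⟨ ℚᵘ.*≡* cross-multiplied ⟩
      ℚᵘ.mkℚᵘ (+ a) n ℚᵘ.+ ℚᵘ.mkℚᵘ (+ b) n              ≈⟨ ℚᵘ.+-cong (toℚᵘ-/ (+ a) n) (toℚᵘ-/ (+ b) n) ⟨
      toℚᵘ (+ a / suc n) ℚᵘ.+ toℚᵘ (+ b / suc n)       ≈⟨ toℚᵘ-homo-+ (+ a / suc n) (+ b / suc n) ⟨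
      toℚᵘ (+ a / suc n + + b / suc n)                 ∎)
    where
      open ℚᵘ.≃-Reasoning
      d = + suc n
      cross-multiplied : + (a ℕ.+ b) ℤ.* (d ℤ.* d) ≡ (+ a ℤ.* d ℤ.+ + b ℤ.* d) ℤ.* d
      cross-multiplied = trans (cong (ℤ._* (d ℤ.* d)) (ℤ.pos-+ a b))
        (ℤS.solve 3 (λ a b d → (a ℤS.:+ b) ℤS.:* (d ℤS.:* d) ℤS.:= (a ℤS.:* d ℤS.:+ b ℤS.:* d) ℤS.:* d) refl (+ a) (+ b) d)

  /≡fromℕ*inv : ∀ s n → + s / suc n ≡ fromℕ s * inv n
  /≡fromℕ*inv zero n = trans (0/n≡0 (suc n)) (sym (*-zeroˡ (inv n)))
  /≡fromℕ*inv (suc s) n = begin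
      + suc s / suc n            ≡⟨ /-distribˡ-+ 1 s n ⟩
      inv n + + s / suc n        ≡⟨ cong (_+_ (inv n)) (/≡fromℕ*inv s n) ⟩
      inv n + fromℕ s * inv n    ≡⟨ solve 2 (λ i a → i :+ a :* i := (con 1ℚ :+ a) :* i) refl (inv n) (fromℕ s) ⟩
      (1ℚ + fromℕ s) * inv n     ∎
    where open ≡-Reasoning

  fromℕ-suc*inv : ∀ n → fromℕ (suc n) * inv n ≡ 1ℚ
  fromℕ-suc*inv n = trans (sym (/≡fromℕ*inv (suc n) n))
    (toℚᵘ-injective (ℚᵘ.≃-trans (toℚᵘ-/ (+ suc n) n) (ℚᵘ.*≡* (ℤ.*-comm (+ suc n) (+ 1)))))

  fromℕ-≤-*inv : ∀ a k {n} → a ℕ.* suc k ℕ.≤ n → fromℕ a ≤ fromℕ n * inv k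
  fromℕ-≤-*inv a k {n} a*[1+k]≤n = begin
      fromℕ a                              ≡⟨ sym (*-identityʳ (fromℕ a)) ⟩
      fromℕ a * 1ℚ                         ≡⟨ cong (fromℕ a *_) (sym (fromℕ-suc*inv k)) ⟩
      fromℕ a * (fromℕ (suc k) * inv k)    ≡⟨ sym (*-assoc (fromℕ a) (fromℕ (suc k)) (inv k)) ⟩
      fromℕ a * fromℕ (suc k) * inv k      ≡⟨ cong (_* inv k) (sym (fromℕ-* a (suc k))) ⟩
      fromℕ (a ℕ.* suc k) * inv k          ≤⟨ *-monoʳ-≤-nonNeg (inv k) {{nonNegative (inv-nonneg k)}} (fromℕ-mono-≤ a*[1+k]≤n) ⟩
      fromℕ n * inv k                      ∎
    where open ≤-Reasoning

  inv*[fromℕ-suc*p]≡p : ∀ n p → inv n * (fromℕ (suc n) * p) ≡ p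
  inv*[fromℕ-suc*p]≡p n p = begin
      inv n * (fromℕ (suc n) * p)   ≡⟨ sym (*-assoc (inv n) (fromℕ (suc n)) p) ⟩
      inv n * fromℕ (suc n) * p     ≡⟨ cong (_* p) (trans (*-comm (inv n) (fromℕ (suc n))) (fromℕ-suc*inv n)) ⟩
      1ℚ * p                        ≡⟨ *-identityˡ p ⟩
      p                             ∎
    where open ≡-Reasoning

  -- Reduces a linear inequality to a known one plus a ring identity, which the solver proves.
  ≤-rearrange : ∀ {a b p q} → a ≤ b → p + b ≡ q + a → p ≤ q
  ≤-rearrange {a} {b} {p} {q} a≤b p+b≡q+a = begin
      p              ≡⟨ solve 2 (λ p a → p := p :+ a :- a) refl p a ⟩
      p + a - a      ≤⟨ +-monoˡ-≤ (- a) (+-monoʳ-≤ p a≤b) ⟩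
      p + b - a      ≡⟨ cong (_- a) p+b≡q+a ⟩
      q + a - a      ≡⟨ solve 2 (λ q a → q :+ a :- a := q) refl q a ⟩
      q              ∎
    where open ≤-Reasoning

  p≤∣p∣ : ∀ p → p ≤ ∣ p ∣
  p≤∣p∣ p with ≤-total 0ℚ p
  ... | inj₁ 0≤p = ≤-reflexive (sym (0≤p⇒∣p∣≡p 0≤p))
  ... | inj₂ p≤0 = ≤-trans p≤0 (0≤∣p∣ p)

  -p≤∣p∣ : ∀ p → - p ≤ ∣ p ∣
  -p≤∣p∣ p = subst (- p ≤_) (∣-p∣≡∣p∣ p) (p≤∣p∣ (- p))

  p≤q∧-p≤q⇒∣p∣≤q : ∀ {p q} → p ≤ q → - p ≤ q → ∣ p ∣ ≤ q
  p≤q∧-p≤q⇒∣p∣≤q {p} p≤q -p≤q with ∣p∣≡p∨∣p∣≡-p p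
  ... | inj₁ ∣p∣≡p = subst (_≤ _) (sym ∣p∣≡p) p≤q
  ... | inj₂ ∣p∣≡-p = subst (_≤ _) (sym ∣p∣≡-p) -p≤q

  seq-≤ : ∀ (x : ℝ) m n → seq x n ≤ seq x m + inv m + inv n
  seq-≤ x m n = ≤-rearrange (≤-trans (-p≤∣p∣ (seq x m - seq x n)) (reg x m n))
    (solve 4 (λ xm xn im in′ → xn :+ (im :+ in′) := xm :+ im :+ in′ :+ :- (xm :- xn)) refl
      (seq x m) (seq x n) (inv m) (inv n))

  fromℕ*-mono-≤ : ∀ a {p q} → p ≤ q → fromℕ a * p ≤ fromℕ a * q
  fromℕ*-mono-≤ a = *-monoˡ-≤-nonNeg (fromℕ a) {{nonNegative (0≤fromℕ a)}}

  inv*-mono-≤ : ∀ n {p q} → p ≤ q → inv n * p ≤ inv n * q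
  inv*-mono-≤ n = *-monoˡ-≤-nonNeg (inv n) {{nonNegative (inv-nonneg n)}}

  ∣s*inv-a∣≤ε : ∀ n s a ε → fromℕ (suc n) * a ≤ s + fromℕ (suc n) * ε →
                s ≤ fromℕ (suc n) * a + fromℕ (suc n) * ε → ∣ s * inv n - a ∣ ≤ ε
  ∣s*inv-a∣≤ε n s a ε lower upper = p≤q∧-p≤q⇒∣p∣≤q
      (≤-rearrange s*w≤a+ε (solve 3 (λ sw a ε → sw :- a :+ (a :+ ε) := ε :+ sw) refl (s * w) a ε))
      (≤-rearrange a≤s*w+ε (solve 3 (λ sw a ε → :- (sw :- a) :+ (sw :+ ε) := ε :+ a) refl (s * w) a ε))
    where
      open ≤-Reasoning
      X = fromℕ (suc n)
      w = inv n
      s*w≤a+ε : s * w ≤ a + ε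
      s*w≤a+ε = begin
          s * w               ≡⟨ *-comm s w ⟩
          w * s               ≤⟨ inv*-mono-≤ n upper ⟩
          w * (X * a + X * ε) ≡⟨ cong (w *_) (sym (*-distribˡ-+ X a ε)) ⟩
          w * (X * (a + ε))   ≡⟨ inv*[fromℕ-suc*p]≡p n (a + ε) ⟩
          a + ε               ∎
      a≤s*w+ε : a ≤ s * w + ε
      a≤s*w+ε = begin
          a                   ≡⟨ sym (inv*[fromℕ-suc*p]≡p n a) ⟩
          w * (X * a)         ≤⟨ inv*-mono-≤ n lower ⟩
          w * (s + X * ε)     ≡⟨ *-distribˡ-+ w s (X * ε) ⟩
          w * s + w * (X * ε) ≡⟨ cong₂ _+_ (*-comm w s) (inv*[fromℕ-suc*p]≡p n ε) ⟩
          s * w + ε           ∎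

  full⇒density-one : ∀ X → (∀ s → X s ≡ true) → HasDensity X oneℝ
  full⇒density-one X full k = 0 , λ n _ m →
    subst (λ q → ∣ q - 1ℚ ∣ ≤ inv k + inv m) (sym (ratio≡1 n)) (+-mono-≤ (inv-nonneg k) (inv-nonneg m))
    where
      ratio≡1 : ∀ n → ratio X n ≡ 1ℚ
      ratio≡1 n = trans (cong (λ c → + c / suc n) (count-full X full (suc n)))
                        (trans (/≡fromℕ*inv (suc n) n) (fromℕ-suc*inv n))

module Greedy (α : ℝ) (α∈[0,1] : InUnitInterval α) (B : NSet) where
  open Counting using (bit; count-suc; Sparse; ∨-introˡ)
  open Rationals
  open import Data.Bool using (Bool; true; false; _∨_)
  open import Data.Nat as ℕ using (ℕ; zero; suc)
  import Data.Nat.Properties as ℕ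
  open import Data.Integer using (+_)
  open import Data.Rational using (ℚ; _+_; _*_; _-_; _/_; ∣_∣; _≤_; _<_; 0ℚ; 1ℚ)
  open import Data.Rational.Properties
  open import Data.Rational.Solver using (module +-*-Solver)
  open import Data.Product using (_,_; proj₁; proj₂)
  open import Relation.Binary.PropositionalEquality
  open import Relation.Nullary using (Dec; yes; no)
  open import Relation.Nullary.Decidable using (⌊_⌋)
  open +-*-Solver

  -- taken n = count greedy n, computed alongside so that the recursion is structural.
  mutual
    greedy : NSet
    greedy zero = true
    greedy (suc n) = B (suc n) ∨ ⌊ fromℕ (taken n) <? fromℕ (suc n) * seq α n ⌋

    taken : ℕ → ℕ
    taken zero = 0
    taken (suc n) = bit (greedy (suc n)) ℕ.+ taken n

  count-greedy : ∀ n → count greedy n ≡ taken n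
  count-greedy zero = refl
  count-greedy (suc n) = trans (count-suc greedy n) (cong (bit (greedy (suc n)) ℕ.+_) (count-greedy n))

  B⊆greedy : ∀ x → B x ≡ true → greedy x ≡ true
  B⊆greedy zero _ = refl
  B⊆greedy (suc x) = ∨-introˡ

  -- In Upper the slack E is 2 plus the number of elements of B met
  -- so far, which the greedy rule does not control.
  Lower : ℚ → ℚ → Set
  Lower N S = ∀ m → N * seq α m ≤ S + 1ℚ + N * inv m

  Upper : ℚ → ℚ → ℚ → Set
  Upper N S E = ∀ m → S ≤ N * seq α m + N * inv m + E

  lower-take : ∀ N S → Lower N S → Lower (1ℚ + N) (1ℚ + S)
  lower-take N S lower m =
    ≤-rearrange (+-mono-≤ (lower m) (proj₂ (α∈[0,1] m)))
      (solve 4 (λ N a S i → (con 1ℚ :+ N) :* a :+ (S :+ con 1ℚ :+ N :* i :+ (con 1ℚ :+ i))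
                          := con 1ℚ :+ S :+ con 1ℚ :+ (con 1ℚ :+ N) :* i :+ (N :* a :+ a)) refl
        N (seq α m) S (inv m))

  lower-skip : ∀ n S → fromℕ (suc n) * seq α n ≤ S → Lower (fromℕ (suc n)) S
  lower-skip n S skipped m =
    ≤-rearrange (+-mono-≤ (+-mono-≤ (fromℕ*-mono-≤ (suc n) (seq-≤ α n m)) skipped) (≤-reflexive (fromℕ-suc*inv n)))
      (solve 6 (λ X aₘ aₙ iₘ iₙ S → X :* aₘ :+ (X :* (aₙ :+ iₙ :+ iₘ) :+ S :+ con 1ℚ)
                                 := S :+ con 1ℚ :+ X :* iₘ :+ (X :* aₘ :+ X :* aₙ :+ X :* iₙ)) refl
        (fromℕ (suc n)) (seq α m) (seq α n) (inv m) (inv n) S)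

  upper-idle : ∀ N S E → Upper N S E → Upper (1ℚ + N) S E
  upper-idle N S E upper m =
    ≤-rearrange (+-mono-≤ (upper m) (proj₁ (α∈[0,1] m)))
      (solve 5 (λ S N a i E → S :+ (N :* a :+ N :* i :+ E :+ a)
                           := (con 1ℚ :+ N) :* a :+ (con 1ℚ :+ N) :* i :+ E :+ (S :+ :- i)) refl
        S N (seq α m) (inv m) E)

  upper-shift : ∀ N S E → Upper N S E → Upper N (1ℚ + S) (1ℚ + E)
  upper-shift N S E upper m =
    ≤-rearrange (upper m)
      (solve 5 (λ S N a i E → con 1ℚ :+ S :+ (N :* a :+ N :* i :+ E)
                           := N :* a :+ N :* i :+ (con 1ℚ :+ E) :+ S) refl
        S N (seq α m) (inv m) E)

  upper-greedy : ∀ n S E → fromℕ 2 ≤ E → S ≤ fromℕ (suc n) * seq α n → Upper (fromℕ (suc n)) (1ℚ + S) E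
  upper-greedy n S E 2≤E chosen m =
    ≤-rearrange (+-mono-≤ (+-mono-≤ (+-mono-≤ chosen (fromℕ*-mono-≤ (suc n) (seq-≤ α m n)))
                                    (≤-reflexive (fromℕ-suc*inv n)))
                          2≤E)
      (solve 7 (λ S X aₘ aₙ iₘ iₙ E → con 1ℚ :+ S :+ (X :* aₙ :+ X :* (aₘ :+ iₘ :+ iₙ) :+ con 1ℚ :+ E)
                                   := X :* aₘ :+ X :* iₘ :+ E :+ (S :+ X :* aₙ :+ X :* iₙ :+ (con 1ℚ :+ (con 1ℚ :+ con 0ℚ)))) refl
        S (fromℕ (suc n)) (seq α m) (seq α n) (inv m) (inv n) E)

  -- b and d are the two operands of _∨_ in greedy (suc n), so that it computes in each case.
  lower-step : ∀ n s (b : Bool) (d : Dec (fromℕ s < fromℕ (suc n) * seq α n)) →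
               Lower (fromℕ n) (fromℕ s) → Lower (fromℕ (suc n)) (fromℕ (bit (b ∨ ⌊ d ⌋) ℕ.+ s))
  lower-step n s true d = lower-take (fromℕ n) (fromℕ s)
  lower-step n s false (yes _) = lower-take (fromℕ n) (fromℕ s)
  lower-step n s false (no s≮) _ = lower-skip n (fromℕ s) (≮⇒≥ s≮)

  upper-step : ∀ n s c (b : Bool) (d : Dec (fromℕ s < fromℕ (suc n) * seq α n)) →
               Upper (fromℕ n) (fromℕ s) (fromℕ (2 ℕ.+ c)) →
               Upper (fromℕ (suc n)) (fromℕ (bit (b ∨ ⌊ d ⌋) ℕ.+ s)) (fromℕ (2 ℕ.+ (bit b ℕ.+ c)))
  upper-step n s c true d upper =
    upper-shift (fromℕ (suc n)) (fromℕ s) (fromℕ (2 ℕ.+ c)) (upper-idle (fromℕ n) (fromℕ s) (fromℕ (2 ℕ.+ c)) upper)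
  upper-step n s c false (yes s<) _ =
    upper-greedy n (fromℕ s) (fromℕ (2 ℕ.+ c)) (fromℕ-mono-≤ (ℕ.m≤m+n 2 c)) (<⇒≤ s<)
  upper-step n s c false (no _) upper = upper-idle (fromℕ n) (fromℕ s) (fromℕ (2 ℕ.+ c)) upper

  taken-lower : ∀ n → Lower (fromℕ n) (fromℕ (taken n))
  taken-lower zero m = ≤-rearrange (0≤fromℕ 1)
    (solve 2 (λ a i → con 0ℚ :* a :+ (con 1ℚ :+ con 0ℚ) := con 0ℚ :+ con 1ℚ :+ con 0ℚ :* i :+ con 0ℚ)
      refl (seq α m) (inv m))
  taken-lower (suc n) = lower-step n (taken n) (B (suc n)) _ (taken-lower n)

  taken-upper : ∀ n → Upper (fromℕ n) (fromℕ (taken n)) (fromℕ (2 ℕ.+ count B n))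
  taken-upper zero m = ≤-rearrange (0≤fromℕ 2)
    (solve 3 (λ a i E → con 0ℚ :+ E := con 0ℚ :* a :+ con 0ℚ :* i :+ E :+ con 0ℚ)
      refl (seq α m) (inv m) (fromℕ 2))
  taken-upper (suc n) = subst (λ c → Upper (fromℕ (suc n)) (fromℕ (taken (suc n))) (fromℕ (2 ℕ.+ c)))
    (sym (count-suc B n)) (upper-step n (taken n) (count B n) (B (suc n)) _ (taken-upper n))

  ratio-greedy : ∀ n → ratio greedy n ≡ fromℕ (taken (suc n)) * inv n
  ratio-greedy n = trans (cong (λ c → + c / suc n) (count-greedy (suc n))) (/≡fromℕ*inv (taken (suc n)) n)

  ratio-greedy-close : ∀ k n → (2 ℕ.+ count B (suc n)) ℕ.* suc k ℕ.≤ suc n →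
                       ∀ m → ∣ ratio greedy n - seq α m ∣ ≤ inv k + inv m
  ratio-greedy-close k n thin m =
    subst (λ q → ∣ q - seq α m ∣ ≤ inv k + inv m) (sym (ratio-greedy n))
      (∣s*inv-a∣≤ε n S (seq α m) (inv k + inv m) lower upper)
    where
      c = count B (suc n)
      X = fromℕ (suc n)
      S = fromℕ (taken (suc n))
      E≤X*iₖ : fromℕ (2 ℕ.+ c) ≤ X * inv k
      E≤X*iₖ = fromℕ-≤-*inv (2 ℕ.+ c) k thin
      lower : X * seq α m ≤ S + X * (inv k + inv m)
      lower = ≤-rearrange
        (+-mono-≤ (taken-lower (suc n) m) (≤-trans (fromℕ-mono-≤ {1} {2 ℕ.+ c} (ℕ.s≤s ℕ.z≤n)) E≤X*iₖ))
        (solve 5 (λ X a S iₖ iₘ → X :* a :+ (S :+ con 1ℚ :+ X :* iₘ :+ X :* iₖ)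
                               := S :+ X :* (iₖ :+ iₘ) :+ (X :* a :+ con 1ℚ)) refl
          X (seq α m) S (inv k) (inv m))
      upper : S ≤ X * seq α m + X * (inv k + inv m)
      upper = ≤-rearrange (+-mono-≤ (taken-upper (suc n) m) E≤X*iₖ)
        (solve 6 (λ X a S iₖ iₘ E → S :+ (X :* a :+ X :* iₘ :+ E :+ X :* iₖ)
                                 := X :* a :+ X :* (iₖ :+ iₘ) :+ (S :+ E)) refl
          X (seq α m) S (inv k) (inv m) (fromℕ (2 ℕ.+ c)))

  greedy-density : Sparse B → HasDensity greedy α
  greedy-density sparse k = proj₁ (sparse k) , λ n N≤n →
    ratio-greedy-close k n (proj₂ (sparse k) (suc n) (ℕ.m≤n⇒m≤1+n N≤n))

open Counting
open Base4Digits
open Rationals using (full⇒density-one)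
open import Data.Product using (_,_)
open import Data.Unit using (tt)
open import Data.Bool using (true)
open import Relation.Binary.PropositionalEquality using (_≡_; refl)

proposition1 : (α : ℝ) → InUnitInterval α →
    ∃ λ (A : NSet) → Normalized A × HasDensity A α × HasDensity (SumSet A) oneℝ
proposition1 α α∈[0,1] =
  greedy , 0∈∧1∈⇒Normalized greedy tt tt , greedy-density thinBasis-sparse ,
  full⇒density-one (SumSet greedy) every-sum
  where
    open Greedy α α∈[0,1] thinBasis
    every-sum : ∀ s → SumSet greedy s ≡ true
    every-sum s with split s
    ... | e , g , e∈ , g∈ , refl = SumSet-intro greedy {e} {g}
      (B⊆greedy e (∪-introˡ digits01 digits02 {e} e∈)) (B⊆greedy g (∪-introʳ digits01 digits02 {g} g∈))
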